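{- Let $r \ge 3$. The question set $\overline{Q}_r$ does not admit exponential parallel repetition; that is, there is no constant $C<1$ such that $\omega_{\overline{Q}_r}(n) \le C^n$ for all $n\in\mathbb{N}$.
   Context: Games: an $r$-prover question set is a finite nonempty $\overline{Q}\subseteq Q^{(1)}\times\cdots\times Q^{(r)}$ with finite $Q^{(j)}$ such that every element of each $Q^{(j)}$ occurs as a $j$-th coordinate of some tuple of $\overline{Q}$. An $r$-prover game with question set $\overline{Q}$ is $(\overline{Q},\overline{A},V)$ with $\overline{A}=A^{(1)}\times\cdots\times A^{(r)}$ a product of finite alphabets and $V:\overline{Q}\times\overline{A}\to\{0,1\}$. A strategy is $(\mathcal{S}^{(1)},\dots,\mathcal{S}^{(r)})$, $\mathcal{S}^{(j)}:Q^{(j)}\to A^{(j)}$; the value is the maximum over strategies of the probability, over $\overline{q}$ uniform on $\overline{Q}$, that $V(\overline{q},\mathcal{S}^{(1)}(q^{(1)}),\dots,\mathcal{S}^{(r)}(q^{(r)}))=1$. A game is trivial if its value is $1$. The $n$-fold parallel repetition $\mathcal{G}^n$ has question set $\overline{Q}^n$ (prover $j$ gets the $n$ $j$-th coordinates), answer alphabets $(A^{(j)})^n$, and accepts iff $V$ accepts in all $n$ coordinates. $\omega_{\overline{Q}}(n)$ is the supremum of $\mathrm{val}(\mathcal{G}^n)$ over all non-trivial games with question set $\overline{Q}$. $\overline{Q}$ admits exponential parallel repetition if there is $C<1$ with $\omega_{\overline{Q}}(n)\le C^n$ for every $n$. $\overline{Q}_r$: $Q^{(j)}=\{0,1\}$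 for all $j$, and $\overline{Q}_r=\{(q^{(1)},\dots,q^{(r)})\in\{0,1\}^r: \text{exactly one } q^{(j)} \text{ equals } 1\}$.
   Formalization: The constant C in the definition of exponential parallel repetition ranges over the rationals. -}

module Defs where

open import Data.Nat using (ℕ; zero; suc; _≟_)
open import Data.Bool using (Bool; true; false; _∧_; if_then_else_)
open import Data.Fin using (Fin; zero; suc)
open import Data.List using (List; []; _∷_; _++_; map; concatMap; length)
open import Data.Vec using (Vec; lookup) renaming ([] to []ᵥ; _∷_ to _∷ᵥ_; map to mapᵥ)
open import Data.Integer using (+_)
open import Data.Rational using (ℚ; 0ℚ; 1ℚ; _/_; _*_)
open import Data.Product using (Σ)
open import Relation.Nullary using (¬_)
open import Relation.Nullary.Decidable using (⌊_⌋)
open import Relation.Binary.PropositionalEquality using (_≡_)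

countB : {A : Set} → (A → Bool) → List A → ℕ
countB p []       = 0
countB p (x ∷ xs) = if p x then suc (countB p xs) else countB p xs

allFinB : (n : ℕ) → (Fin n → Bool) → Bool
allFinB zero    f = true
allFinB (suc n) f = f zero ∧ allFinB n (λ k → f (suc k))

sumFin : (n : ℕ) → (Fin n → ℕ) → ℕ
sumFin zero    f = 0
sumFin (suc n) f = f zero Data.Nat.+ sumFin n (λ k → f (suc k))

-- c / d as a rational (d = 0 never occurs for nonempty question sets;
-- the value 0 is an arbitrary convention there)
ratio : ℕ → ℕ → ℚ
ratio c zero    = 0ℚ
ratio c (suc d) = (+ c) / suc d

_^ℚ_ : ℚ → ℕ → ℚ
x ^ℚ zero  = 1ℚ
x ^ℚ suc n = x * (x ^ℚ n)

allBoolTuples : (r : ℕ) → List (Fin r → Bool)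
allBoolTuples zero    = (λ ()) ∷ []
allBoolTuples (suc r) =
  concatMap (λ q → (λ { zero → false ; (suc j) → q j })
                 ∷ (λ { zero → true  ; (suc j) → q j }) ∷ [])
            (allBoolTuples r)

allVecs : {A : Set} → List A → (n : ℕ) → List (Vec A n)
allVecs xs zero    = []ᵥ ∷ []
allVecs xs (suc n) = concatMap (λ x → map (x ∷ᵥ_) (allVecs xs n)) xs

-- r-prover games whose question alphabets are Q^(j) = {0,1} = Bool.
-- A question set is given by the list of its tuples (uniform distribution
-- over the list entries).

QuestionList : ℕ → Set
QuestionList r = List (Fin r → Bool)

bit : Bool → ℕ
bit true  = 1
bit false = 0

exactlyOne : {r : ℕ} → (Fin r → Bool) → Bool
exactlyOne {r} q = ⌊ sumFin r (λ j → bit (q j)) ≟ 1 ⌋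

Qbar : (r : ℕ) → QuestionList r
Qbar r = Data.List.filterᵇ exactlyOne (allBoolTuples r)

-- A game with question set Qs: finite nonempty answer alphabets
-- A^(j) = Fin (suc (ansSize j)) and a verifier V.
record Game (r : ℕ) (Qs : QuestionList r) : Set where
  field
    ansSize : Fin r → ℕ
    V       : (Fin r → Bool) → ((j : Fin r) → Fin (suc (ansSize j))) → Bool

module _ {r : ℕ} {Qs : QuestionList r} (G : Game r Qs) where
  open Game G

  Answer : Fin r → Set
  Answer j = Fin (suc (ansSize j))

  Strategy : Set
  Strategy = (j : Fin r) → Bool → Answer j

  successProb : Strategy → ℚ
  successProb S =
    ratio (countB (λ q → V q (λ j → S j (q j))) Qs) (length Qs)

  -- G is trivial iff its value (max over strategies) is 1,
  -- i.e. some strategy wins with probability 1.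
  Trivial : Set
  Trivial = Σ Strategy (λ S → successProb S ≡ 1ℚ)

  NonTrivial : Set
  NonTrivial = ¬ Trivial

  RepStrategy : ℕ → Set
  RepStrategy n = (j : Fin r) → Vec Bool n → Vec (Answer j) n

  repAccepts : (n : ℕ) → RepStrategy n → Vec (Fin r → Bool) n → Bool
  repAccepts n S qv =
    allFinB n (λ k → V (lookup qv k)
                       (λ j → lookup (S j (mapᵥ (λ q → q j) qv)) k))

  repSuccessProb : (n : ℕ) → RepStrategy n → ℚ
  repSuccessProb n S =
    ratio (countB (repAccepts n S) (allVecs Qs n)) (length (allVecs Qs n))

-- ω_Qs(n) ≤ x : every strategy of every repeated non-trivial game
-- with question set Qs succeeds with probability at most x
-- (i.e. the supremum of val(G^n) over non-trivial G is ≤ x).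
OmegaLe : {r : ℕ} → QuestionList r → ℕ → ℚ → Set
OmegaLe {r} Qs n x =
  (G : Game r Qs) → NonTrivial G → (S : RepStrategy G n) →
  Data.Rational._≤_ (repSuccessProb G n S) x

AdmitsExpParRep : {r : ℕ} → QuestionList r → Set
AdmitsExpParRep Qs =
  Σ ℚ (λ C → Data.Rational._<_ C 1ℚ Data.Product.× ((n : ℕ) → OmegaLe Qs n (C ^ℚ n)))

-- For every n we build a non-trivial game G with question set Q̄_r whose n-fold
-- repetition still has value at least 1/(2n+1); as 1/(2n+1) is not bounded by C^n
-- for any C < 1, exponential parallel repetition fails.
--
-- In each coordinate k of the repetition, prover j answers with a claim (x, k), x being
-- the whole vector of n questions it received. The verifier checks that all claims name
-- the same coordinate, agree there with the actual question, form a sequence of n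
-- questions from Q̄_r, and that the numbers of 1s claimed by provers 0 and 1 satisfy
-- t + #x₀ = n + #x₁ for a fixed offset t. Honest provers win whenever their real
-- counts satisfy this; since #x₁ − #x₀ takes at most 2n + 1 values, pigeonhole picks
-- an offset t met by at least a 1/(2n+1) fraction of the question sequences.
-- In a single round, however, the claims cannot be valid at all three questions
-- e₀, e₁, e₂, where eᵢ gives a 1 to prover i only (this is where r ≥ 3 is used),
-- so G is non-trivial.

module Submission where

open import Defs
open import Data.Bool using (Bool; true; false; T; T?)
import Data.Bool as Bool
open import Data.Bool.Properties using (T-≡; T-∧)
open import Data.Empty using (⊥; ⊥-elim)
open import Data.Fin using (Fin; zero; suc)
import Data.Fin as Fin
open import Data.Fin.Properties using (all?; toℕ-fromℕ<)
import Data.Integer as ℤ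
import Data.Integer.Properties as ℤ
open import Data.List using (List; []; _∷_; length; map; cartesianProduct; allFin)
import Data.List as List
open import Data.List.Membership.Propositional using (_∈_; find)
open import Data.List.Membership.Propositional.Properties
  using (∈-filter⁺; ∈-filter⁻; ∈-concatMap⁺; ∈-concatMap⁻; ∈-map⁺; ∈-map⁻; ∈-cartesianProduct⁺; ∈-allFin)
open import Data.List.Relation.Unary.Any as Any using (here; there)
open import Data.List.Relation.Unary.Any.Properties using (lookup-index)
open import Data.Nat using (ℕ; zero; suc; pred; _+_; _*_; _∸_; _^_; _≤_; _<_; z≤n; s≤s; _≤?_)
import Data.Nat as ℕ
open import Data.Nat.Properties
open import Data.Nat.Tactic.RingSolver using (solve-∀)
open import Data.Product using (∃; _×_; _,_; proj₁; proj₂)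
open import Data.Rational using (mkℚ; 1ℚ; toℚᵘ; ↥_; ↧ₙ_)
import Data.Rational as ℚ
open import Data.Rational.Properties using (toℚᵘ-fromℚᵘ; toℚᵘ-cancel-≤; toℚᵘ-cancel-<; toℚᵘ-homo-*)
import Data.Rational.Properties as ℚ
open import Data.Rational.Unnormalised using (mkℚᵘ)
import Data.Rational.Unnormalised as ℚᵘ
import Data.Rational.Unnormalised.Properties as ℚᵘ
open import Data.Unit using (tt)
open import Data.Vec using (Vec; lookup; replicate; tabulate) renaming ([] to []ᵥ; _∷_ to _∷ᵥ_; map to mapᵥ)
open import Data.Vec.Properties using (lookup-map; lookup∘tabulate; lookup-replicate)
open import Function using (_∘_)
open import Function.Bundles using (Equivalence)
open import Relation.Nullary using (¬_; Dec; yes; no)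
open import Relation.Nullary.Decidable using (⌊_⌋; toWitness; fromWitness; _×-dec_)
open import Relation.Binary.PropositionalEquality

open import Algebra.Properties.CommutativeSemigroup +-commutativeSemigroup using (interchange)

private
  variable
    A : Set

sumFin-cong : ∀ n {f g : Fin n → ℕ} → (∀ k → f k ≡ g k) → sumFin n f ≡ sumFin n g
sumFin-cong zero    f≗g = refl
sumFin-cong (suc n) f≗g = cong₂ _+_ (f≗g zero) (sumFin-cong n (f≗g ∘ suc))

sumFin-+ : ∀ n (f g : Fin n → ℕ) → sumFin n (λ k → f k + g k) ≡ sumFin n f + sumFin n g
sumFin-+ zero    f g = refl
sumFin-+ (suc n) f g = begin
  f zero + g zero + sumFin n (λ k → f (suc k) + g (suc k))  ≡⟨ cong ((f zero + g zero) +_) (sumFin-+ n (f ∘ suc) (g ∘ suc)) ⟩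
  f zero + g zero + (sumFin n (f ∘ suc) + sumFin n (g ∘ suc)) ≡⟨ interchange (f zero) (g zero) _ _ ⟩
  f zero + sumFin n (f ∘ suc) + (g zero + sumFin n (g ∘ suc)) ∎
  where open ≡-Reasoning

sumFin-mono : ∀ n {f g : Fin n → ℕ} → (∀ k → f k ≤ g k) → sumFin n f ≤ sumFin n g
sumFin-mono zero    f≤g = z≤n
sumFin-mono (suc n) f≤g = +-mono-≤ (f≤g zero) (sumFin-mono n (f≤g ∘ suc))

sumFin-mono-< : ∀ n {f g : Fin n → ℕ} → (∀ k → f k ≤ g k) → ∀ κ → f κ < g κ → sumFin n f < sumFin n g
sumFin-mono-< (suc n) f≤g zero    f<g = +-mono-<-≤ f<g (sumFin-mono n (f≤g ∘ suc))
sumFin-mono-< (suc n) f≤g (suc κ) f<g = +-mono-≤-< (f≤g zero) (sumFin-mono-< n (f≤g ∘ suc) κ f<g)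

≤-sumFin : ∀ n (f : Fin n → ℕ) k → f k ≤ sumFin n f
≤-sumFin (suc n) f zero    = m≤m+n (f zero) _
≤-sumFin (suc n) f (suc k) = ≤-trans (≤-sumFin n (f ∘ suc) k) (m≤n+m _ (f zero))

sumFin-zero : ∀ n → sumFin n (λ _ → 0) ≡ 0
sumFin-zero zero    = refl
sumFin-zero (suc n) = sumFin-zero n

sumFin-bits≤ : ∀ n (f : Fin n → Bool) → sumFin n (λ k → bit (f k)) ≤ n
sumFin-bits≤ zero    f = z≤n
sumFin-bits≤ (suc n) f = +-mono-≤ (bit≤1 (f zero)) (sumFin-bits≤ n (f ∘ suc))
  where
  bit≤1 : ∀ b → bit b ≤ 1
  bit≤1 true  = s≤s z≤n
  bit≤1 false = z≤n

sumFin≤*-max : ∀ m (g : Fin (suc m) → ℕ) → ∃ λ k → sumFin (suc m) g ≤ suc m * g k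
sumFin≤*-max zero    g = zero , ≤-refl
sumFin≤*-max (suc m) g with sumFin≤*-max m (g ∘ suc)
... | k , ih with g zero ≤? g (suc k)
...   | yes g₀≤ = suc k , +-mono-≤ g₀≤ ih
...   | no  g₀≰ = zero , +-monoʳ-≤ (g zero) (≤-trans ih (*-monoʳ-≤ (suc m) (<⇒≤ (≰⇒> g₀≰))))

allFinB-intro : ∀ n {f : Fin n → Bool} → (∀ k → T (f k)) → T (allFinB n f)
allFinB-intro zero    all = tt
allFinB-intro (suc n) all = Equivalence.from T-∧ (all zero , allFinB-intro n (all ∘ suc))

countB-∷ : (p : A → Bool) (x : A) (xs : List A) → countB p (x ∷ xs) ≡ bit (p x) + countB p xs
countB-∷ p x xs with p x
... | true  = refl
... | false = refl

countB≤length : (p : A → Bool) (xs : List A) → countB p xs ≤ length xs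
countB≤length p []       = z≤n
countB≤length p (x ∷ xs) with p x
... | true  = s≤s (countB≤length p xs)
... | false = m≤n⇒m≤1+n (countB≤length p xs)

countB≡length⇒T : (p : A → Bool) (xs : List A) → countB p xs ≡ length xs → ∀ {x} → x ∈ xs → T (p x)
countB≡length⇒T p (y ∷ xs) full y∈ with p y in py
countB≡length⇒T p (y ∷ xs) full (here refl) | true = Equivalence.from T-≡ py
countB≡length⇒T p (y ∷ xs) full (there x∈) | true = countB≡length⇒T p xs (suc-injective full) x∈
... | false = ⊥-elim (1+n≰n (subst (_≤ length xs) full (countB≤length p xs)))

countB-mono : {p q : A → Bool} (xs : List A) → (∀ {x} → x ∈ xs → T (p x) → T (q x)) → countB p xs ≤ countB q xs
countB-mono []       p⇒q = z≤n
countB-mono {p = p} {q} (x ∷ xs) p⇒q with p x | q x | p⇒q (here refl)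
... | true  | true  | _ = s≤s (countB-mono xs (p⇒q ∘ there))
... | true  | false | h = ⊥-elim (h tt)
... | false | true  | _ = m≤n⇒m≤1+n (countB-mono xs (p⇒q ∘ there))
... | false | false | _ = countB-mono xs (p⇒q ∘ there)

length≤sumFin-countB : ∀ m (P : Fin m → A → Bool) → (∀ x → ∃ λ k → T (P k x)) →
                       ∀ xs → length xs ≤ sumFin m (λ k → countB (P k) xs)
length≤sumFin-countB m P cover []       = z≤n
length≤sumFin-countB m P cover (x ∷ xs) = begin
  1 + length xs
    ≤⟨ +-mono-≤ hit (length≤sumFin-countB m P cover xs) ⟩
  sumFin m (λ k → bit (P k x)) + sumFin m (λ k → countB (P k) xs)
    ≡⟨ sumFin-+ m _ _ ⟨
  sumFin m (λ k → bit (P k x) + countB (P k) xs)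
    ≡⟨ sumFin-cong m (λ k → countB-∷ (P k) x xs) ⟨
  sumFin m (λ k → countB (P k) (x ∷ xs)) ∎
  where
  open ≤-Reasoning
  bit-T : ∀ {b} → T b → 1 ≤ bit b
  bit-T {true} _ = ≤-refl
  hit : 1 ≤ sumFin m (λ k → bit (P k x))
  hit = let k , Pkx = cover x in ≤-trans (bit-T Pkx) (≤-sumFin m _ k)

pigeonhole-countB : ∀ m (P : Fin (suc m) → A → Bool) → (∀ x → ∃ λ k → T (P k x)) →
                    ∀ xs → ∃ λ k → length xs ≤ suc m * countB (P k) xs
pigeonhole-countB m P cover xs =
  let k , max = sumFin≤*-max m (λ k → countB (P k) xs)
  in  k , ≤-trans (length≤sumFin-countB (suc m) P cover xs) max

∈⇒1≤length : ∀ {x : A} {xs} → x ∈ xs → 1 ≤ length xs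
∈⇒1≤length (here _)  = s≤s z≤n
∈⇒1≤length (there _) = s≤s z≤n

∈-allVecs⁺ : {xs : List A} → ∀ {n} {v : Vec A n} → (∀ p → lookup v p ∈ xs) → v ∈ allVecs xs n
∈-allVecs⁺ {v = []ᵥ}     v⊆xs = here refl
∈-allVecs⁺ {xs = xs} {suc n} {x ∷ᵥ v} v⊆xs =
  ∈-concatMap⁺ (λ y → map (y ∷ᵥ_) (allVecs xs n))
    (Any.map (λ { refl → ∈-map⁺ (x ∷ᵥ_) (∈-allVecs⁺ (v⊆xs ∘ suc)) }) (v⊆xs zero))

∈-allVecs⁻ : {xs : List A} → ∀ {n} {v : Vec A n} → v ∈ allVecs xs n → ∀ p → lookup v p ∈ xs
∈-allVecs⁻ {xs = xs} {suc n} v∈ p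
  with find (∈-concatMap⁻ (λ y → map (y ∷ᵥ_) (allVecs xs n)) {xs = xs} v∈)
... | x , x∈xs , v∈x∷ with ∈-map⁻ (x ∷ᵥ_) v∈x∷
...   | w , w∈ , refl with p
...     | zero   = x∈xs
...     | suc p' = ∈-allVecs⁻ w∈ p'

-- Without function extensionality, tuples are found in the enumerations only up to
-- pointwise equality.
allBoolTuples-complete : ∀ r (e : Fin r → Bool) → ∃ λ q → q ∈ allBoolTuples r × (∀ j → q j ≡ e j)
allBoolTuples-complete zero    e = _ , here refl , λ ()
allBoolTuples-complete (suc r) e with allBoolTuples-complete r (e ∘ suc) | e zero in e₀
... | q , q∈ , q≗e | false =
  _ , ∈-concatMap⁺ _ (Any.map (λ { refl → here refl }) q∈) , λ { zero → sym e₀ ; (suc j) → q≗e j }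
... | q , q∈ , q≗e | true  =
  _ , ∈-concatMap⁺ _ (Any.map (λ { refl → there (here refl) }) q∈) , λ { zero → sym e₀ ; (suc j) → q≗e j }

Qbar-partition : ∀ {r} {q : Fin r → Bool} → q ∈ Qbar r → sumFin r (λ j → bit (q j)) ≡ 1
Qbar-partition {r} q∈ = toWitness (proj₂ (∈-filter⁻ (T? ∘ exactlyOne) {xs = allBoolTuples r} q∈))

Qbar-complete : ∀ {r} (e : Fin r → Bool) → sumFin r (λ j → bit (e j)) ≡ 1 →
                ∃ λ q → q ∈ Qbar r × (∀ j → q j ≡ e j)
Qbar-complete {r} e partition =
  let q , q∈ , q≗e = allBoolTuples-complete r e
  in  q , ∈-filter⁺ (T? ∘ exactlyOne) q∈ (fromWitness (trans (sumFin-cong r (cong bit ∘ q≗e)) partition)) , q≗e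

unit : ∀ {r} → Fin r → Fin r → Bool
unit zero    zero    = true
unit zero    (suc j) = false
unit (suc i) zero    = false
unit (suc i) (suc j) = unit i j

sumFin-unit : ∀ {r} (i : Fin r) → sumFin r (λ j → bit (unit i j)) ≡ 1
sumFin-unit {suc r} zero    = cong suc (sumFin-zero r)
sumFin-unit {suc r} (suc i) = sumFin-unit i

-- Bernoulli's inequality (1 + 1/p)ᵐ ≥ 1 + m/p with denominators cleared.
pow*linear≤pow : ∀ p m → p ^ m * (p + m) ≤ p * suc p ^ m
pow*linear≤pow p zero    = ≤-reflexive (base p)
  where
  base : ∀ p → 1 * (p + 0) ≡ p * 1
  base = solve-∀
pow*linear≤pow p (suc m) = begin
  p * p ^ m * (p + suc m)    ≡⟨ step₁ p (p ^ m) m ⟩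
  p ^ m * (p * (p + suc m))  ≤⟨ *-monoʳ-≤ (p ^ m) (≤-trans (m≤m+n _ m) (≤-reflexive (step₂ p m))) ⟩
  p ^ m * ((p + m) * suc p)  ≡⟨ *-assoc (p ^ m) (p + m) (suc p) ⟨
  p ^ m * (p + m) * suc p    ≤⟨ *-monoˡ-≤ (suc p) (pow*linear≤pow p m) ⟩
  p * suc p ^ m * suc p      ≡⟨ step₃ p (suc p ^ m) ⟩
  p * (suc p * suc p ^ m)    ∎
  where
  open ≤-Reasoning
  step₁ : ∀ p x m → p * x * (p + suc m) ≡ x * (p * (p + suc m))
  step₁ = solve-∀
  step₂ : ∀ p m → p * (p + suc m) + m ≡ (p + m) * suc p
  step₂ = solve-∀
  step₃ : ∀ p y → p * y * suc p ≡ p * (suc p * y)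
  step₃ = solve-∀

two*pow≤pow : ∀ p → 2 * suc p ^ suc p ≤ suc (suc p) ^ suc p
two*pow≤pow p = *-cancelˡ-≤ (suc p)
  (≤-trans (≤-reflexive (rearrange (suc p) (suc p ^ suc p))) (pow*linear≤pow (suc p) (suc p)))
  where
  rearrange : ∀ p x → p * (2 * x) ≡ x * (p + p)
  rearrange = solve-∀

two^k*pow≤pow : ∀ p k → 2 ^ k * suc p ^ (suc p * k) ≤ suc (suc p) ^ (suc p * k)
two^k*pow≤pow p zero    rewrite *-zeroʳ p = ≤-refl
two^k*pow≤pow p (suc k) = begin
  2 ^ suc k * P ^ (P * suc k)                  ≡⟨ cong (λ e → 2 ^ suc k * P ^ e) (*-suc P k) ⟩
  2 ^ suc k * P ^ (P + P * k)                  ≡⟨ cong (2 ^ suc k *_) (^-distribˡ-+-* P P (P * k)) ⟩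
  2 * 2 ^ k * (P ^ P * P ^ (P * k))            ≡⟨ interchange-* (2 ^ k) (P ^ P) (P ^ (P * k)) ⟩
  2 * P ^ P * (2 ^ k * P ^ (P * k))            ≤⟨ *-mono-≤ (two*pow≤pow p) (two^k*pow≤pow p k) ⟩
  suc P ^ P * suc P ^ (P * k)                  ≡⟨ ^-distribˡ-+-* (suc P) P (P * k) ⟨
  suc P ^ (P + P * k)                          ≡⟨ cong (suc P ^_) (*-suc P k) ⟨
  suc P ^ (P * suc k)                          ∎
  where
  open ≤-Reasoning
  P = suc p
  interchange-* : ∀ x y z → 2 * x * (y * z) ≡ 2 * y * (x * z)
  interchange-* = solve-∀

square≤two^ : ∀ j → (4 + j) * (4 + j) ≤ 2 ^ (4 + j)
square≤two^ zero    = ≤-refl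
square≤two^ (suc j) = begin
  (5 + j) * (5 + j)                      ≡⟨ expand j ⟩
  (4 + j) * (4 + j) + (9 + 2 * j)        ≤⟨ +-monoʳ-≤ ((4 + j) * (4 + j))
                                              (≤-trans (m≤m+n _ (7 + j * (6 + j))) (≤-reflexive (complete j))) ⟩
  (4 + j) * (4 + j) + (4 + j) * (4 + j)  ≤⟨ +-mono-≤ (square≤two^ j) (square≤two^ j) ⟩
  2 ^ (4 + j) + 2 ^ (4 + j)              ≡⟨ cong (2 ^ (4 + j) +_) (+-identityʳ (2 ^ (4 + j))) ⟨
  2 ^ (5 + j)                            ∎
  where
  open ≤-Reasoning
  expand : ∀ j → (5 + j) * (5 + j) ≡ (4 + j) * (4 + j) + (9 + 2 * j)
  expand = solve-∀
  complete : ∀ j → 9 + 2 * j + (7 + j * (6 + j)) ≡ (4 + j) * (4 + j)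
  complete = solve-∀

-- For p ≥ 1 take n = p(4 + 2p): then (1 + 1/p)ⁿ ≥ 2^(4+2p) > 2n + 1.
linear*pow<pow : ∀ {p q} → p < q → ∃ λ n → (suc (suc n) + suc n) * p ^ suc n < q ^ suc n
linear*pow<pow {zero}  {q} 0<q = 0 , subst (0 <_) (sym (*-identityʳ q)) 0<q
linear*pow<pow {suc p} {q} p<q = pred N , (begin-strict
  (suc N + N) * P ^ N  <⟨ *-monoˡ-< (P ^ N) {{m^n≢0 P N}} linear<two^K ⟩
  2 ^ K * P ^ N        ≤⟨ two^k*pow≤pow p K ⟩
  suc P ^ N            ≤⟨ ^-monoˡ-≤ N p<q ⟩
  q ^ N                ∎)
  where
  open ≤-Reasoning
  P = suc p
  j = P + P
  K = 4 + j
  N = P * K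
  linear<two^K : suc N + N < 2 ^ K
  linear<two^K = ≤-trans (≤-reflexive (shape P))
                   (≤-trans (m≤m+n _ (14 + 8 * P)) (≤-trans (≤-reflexive (expand P)) (square≤two^ j)))
    where
    shape : ∀ P → suc (suc (P * (4 + (P + P)) + P * (4 + (P + P)))) ≡ 2 + 2 * P * (4 + (P + P))
    shape = solve-∀
    expand : ∀ P → 2 + 2 * P * (4 + (P + P)) + (14 + 8 * P) ≡ (4 + (P + P)) * (4 + (P + P))
    expand = solve-∀

ratio≡1⇒≡ : ∀ c m → ratio c m ≡ 1ℚ → c ≡ m
ratio≡1⇒≡ c zero    ()
ratio≡1⇒≡ c (suc d) ratio≡1 with subst (λ x → toℚᵘ x ℚᵘ.≃ mkℚᵘ (ℤ.+ c) d) ratio≡1 (toℚᵘ-fromℚᵘ (mkℚᵘ (ℤ.+ c) d))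
... | ℚᵘ.*≡* eq = ℤ.+-injective (trans (sym (ℤ.*-identityʳ (ℤ.+ c))) (trans (sym eq) (ℤ.*-identityˡ (ℤ.+ suc d))))

reciprocal≤ratio : ∀ m g len → 1 ≤ len → len ≤ suc m * g → ratio 1 (suc m) ℚ.≤ ratio g len
reciprocal≤ratio m g (suc d) _ len≤ =
  toℚᵘ-cancel-≤ (ℚᵘ.≤-respˡ-≃ (ℚᵘ.≃-sym (toℚᵘ-fromℚᵘ (mkℚᵘ (ℤ.+ 1) m)))
                (ℚᵘ.≤-respʳ-≃ (ℚᵘ.≃-sym (toℚᵘ-fromℚᵘ (mkℚᵘ (ℤ.+ g) d))) (ℚᵘ.*≤* cross)))
  where
  cross : ℤ.+ 1 ℤ.* ℤ.+ suc d ℤ.≤ ℤ.+ g ℤ.* ℤ.+ suc m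
  cross = subst₂ ℤ._≤_ (sym (ℤ.*-identityˡ (ℤ.+ suc d))) (ℤ.pos-* g (suc m))
                 (ℤ.+≤+ (≤-trans len≤ (≤-reflexive (*-comm (suc m) g))))

toℚᵘ-^ℚ : ∀ C {p} → ↥ C ≡ ℤ.+ p → ∀ n → toℚᵘ (C ^ℚ n) ℚᵘ.≃ mkℚᵘ (ℤ.+ (p ^ n)) (pred (↧ₙ C ^ n))
toℚᵘ-^ℚ C                 _    zero    = ℚᵘ.≃-refl
toℚᵘ-^ℚ C@(mkℚ _ d _) {p} refl (suc n) =
  ℚᵘ.≃-trans (toℚᵘ-homo-* C (C ^ℚ n)) (ℚᵘ.≃-trans (ℚᵘ.*-congˡ {toℚᵘ C} (toℚᵘ-^ℚ C refl n)) (ℚᵘ.*≡* cross))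
  where
  D = suc d ^ n
  cross : ℤ.+ p ℤ.* ℤ.+ (p ^ n) ℤ.* ℤ.+ suc (pred (suc d * D))
        ≡ ℤ.+ (p * p ^ n) ℤ.* ℤ.+ suc (pred (suc d * suc (pred D)))
  cross = cong₂ ℤ._*_ (sym (ℤ.pos-* p (p ^ n)))
                (cong (λ x → ℤ.+ suc (pred (suc d * x))) (sym (suc-pred D {{m^n≢0 (suc d) n}})))

^ℚ<reciprocal : ∀ {C} → C ℚ.< 1ℚ → ∃ λ n → C ^ℚ suc n ℚ.< ratio 1 (suc (suc n) + suc n)
^ℚ<reciprocal {C@(mkℚ (ℤ.+ p) d _)} (ℚ.*<* C<1) =
  let n , small = linear*pow<pow p<d
      N = suc n
      cross : ℤ.+ (p ^ N) ℤ.* ℤ.+ suc (N + N) ℤ.< ℤ.+ 1 ℤ.* ℤ.+ suc (pred (suc d ^ N))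
      cross = subst₂ ℤ._<_ (ℤ.pos-* (p ^ N) (suc (N + N)))
                (trans (cong ℤ.+_ (sym (suc-pred (suc d ^ N) {{m^n≢0 (suc d) N}}))) (sym (ℤ.*-identityˡ _)))
                (ℤ.+<+ (subst (_< suc d ^ N) (*-comm (suc (N + N)) (p ^ N)) small))
  in  n , toℚᵘ-cancel-< (ℚᵘ.<-respˡ-≃ (ℚᵘ.≃-sym (toℚᵘ-^ℚ C refl N))
                          (ℚᵘ.<-respʳ-≃ (ℚᵘ.≃-sym (toℚᵘ-fromℚᵘ (mkℚᵘ (ℤ.+ 1) (N + N)))) (ℚᵘ.*<* cross)))
  where
  p<d : p < suc d
  p<d = ℤ.drop‿+<+ (subst₂ ℤ._<_ (ℤ.*-identityʳ (ℤ.+ p)) (ℤ.*-identityˡ (ℤ.+ suc d)) C<1)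
^ℚ<reciprocal {C@(mkℚ ℤ.-[1+ _ ] _ _)} _ =
  0 , subst (ℚ._< ratio 1 3) (sym (ℚ.*-identityʳ C)) (ℚ.neg<pos C (ratio 1 3))

Claim : ℕ → Set
Claim n = Vec Bool n × Fin n

ones : ∀ {n} → Vec Bool n → ℕ
ones {n} v = sumFin n (λ p → bit (lookup v p))

ones≤length : ∀ {n} (v : Vec Bool n) → ones v ≤ n
ones≤length {n} v = sumFin-bits≤ n (lookup v)

Valid : ∀ {s n} → ℕ → (Fin (suc (suc s)) → Bool) → (Fin (suc (suc s)) → Claim n) → Set
Valid {s} {n} t q c =
  (∀ j → proj₂ (c j) ≡ proj₂ (c zero)) ×
  (∀ p → sumFin (suc (suc s)) (λ j → bit (lookup (proj₁ (c j)) p)) ≡ 1) ×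
  (∀ j → lookup (proj₁ (c j)) (proj₂ (c zero)) ≡ q j) ×
  (t + ones (proj₁ (c zero)) ≡ n + ones (proj₁ (c (suc zero))))

valid? : ∀ {s n} t q (c : Fin (suc (suc s)) → Claim n) → Dec (Valid t q c)
valid? {s} {n} t q c =
  all? (λ j → proj₂ (c j) Fin.≟ proj₂ (c zero)) ×-dec
  all? (λ p → sumFin (suc (suc s)) (λ j → bit (lookup (proj₁ (c j)) p)) ℕ.≟ 1) ×-dec
  all? (λ j → lookup (proj₁ (c j)) (proj₂ (c zero)) Bool.≟ q j) ×-dec
  (t + ones (proj₁ (c zero)) ℕ.≟ n + ones (proj₁ (c (suc zero))))

Valid-resp : ∀ {s n t} {q q' : Fin (suc (suc s)) → Bool} {c c' : Fin (suc (suc s)) → Claim n} →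
             (∀ j → q j ≡ q' j) → (∀ j → c j ≡ c' j) → Valid t q c → Valid t q' c'
Valid-resp {s} {n} {t} q≗q' c≗c' (sameRound , partition , consistent , offset) =
    (λ j → trans (cong proj₂ (sym (c≗c' j))) (trans (sameRound j) (cong proj₂ (c≗c' zero))))
  , (λ p → trans (sumFin-cong (suc (suc s)) λ j → cong (λ x → bit (lookup (proj₁ x) p)) (sym (c≗c' j)))
                 (partition p))
  , (λ j → trans (cong₂ (λ x y → lookup (proj₁ x) (proj₂ y)) (sym (c≗c' j)) (sym (c≗c' zero)))
                 (trans (consistent j) (q≗q' j)))
  , subst₂ (λ x y → t + ones (proj₁ x) ≡ n + ones (proj₁ y)) (c≗c' zero) (c≗c' (suc zero)) offset

claims : (n : ℕ) → List (Claim n)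
claims n = cartesianProduct (allVecs (true ∷ false ∷ []) n) (allFin n)

∈-claims : ∀ {n} (c : Claim n) → c ∈ claims n
∈-claims (v , k) = ∈-cartesianProduct⁺ (∈-allVecs⁺ (λ p → bool∈ (lookup v p))) (∈-allFin k)
  where
  bool∈ : ∀ b → b ∈ true ∷ false ∷ []
  bool∈ true  = here refl
  bool∈ false = there (here refl)

encodeClaim : ∀ {n} → Claim n → Fin (suc (length (claims n)))
encodeClaim c = suc (Any.index (∈-claims c))

-- Answer 0 is never used by the honest provers; it decodes to an arbitrary claim.
decodeClaim : ∀ n → Fin (suc (length (claims (suc n)))) → Claim (suc n)
decodeClaim n = List.lookup ((replicate (suc n) false , zero) ∷ claims (suc n))

decode-encodeClaim : ∀ {n} (c : Claim (suc n)) → decodeClaim n (encodeClaim c) ≡ c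
decode-encodeClaim c = sym (lookup-index (∈-claims c))

offsetGame : ∀ s n → ℕ → Game (suc (suc s)) (Qbar (suc (suc s)))
offsetGame s n t = record
  { ansSize = λ _ → length (claims (suc n))
  ; V       = λ q a → ⌊ valid? t q (λ j → decodeClaim n (a j)) ⌋
  }

honest : ∀ s n t → RepStrategy (offsetGame s n t) (suc n)
honest s n t j xs = tabulate (λ k → encodeClaim (xs , k))

column : ∀ {r n} → Fin r → Vec (Fin r → Bool) n → Vec Bool n
column j = mapᵥ (λ q → q j)

balanced : ∀ {s n} → ℕ → Vec (Fin (suc (suc s)) → Bool) n → Bool
balanced {n = n} t qv = ⌊ t + ones (column zero qv) ℕ.≟ n + ones (column (suc zero) qv) ⌋

honest-wins : ∀ s n t {qv} → qv ∈ allVecs (Qbar (suc (suc s))) (suc n) → T (balanced t qv) →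
              T (repAccepts (offsetGame s n t) (suc n) (honest s n t) qv)
honest-wins s n t {qv} qv∈ bal = allFinB-intro (suc n) accepted
  where
  honest-valid : ∀ k → Valid t (lookup qv k) (λ j → column j qv , k)
  honest-valid k =
      (λ j → refl)
    , (λ p → trans (sumFin-cong (suc (suc s)) (λ j → cong bit (lookup-map p (λ q → q j) qv)))
                   (Qbar-partition (∈-allVecs⁻ qv∈ p)))
    , (λ j → lookup-map k (λ q → q j) qv)
    , toWitness bal
  decoded : ∀ j k → decodeClaim n (lookup (honest s n t j (column j qv)) k) ≡ (column j qv , k)
  decoded j k = trans (cong (decodeClaim n) (lookup∘tabulate (λ k → encodeClaim (column j qv , k)) k))
                      (decode-encodeClaim _)
  accepted : ∀ k → T (Game.V (offsetGame s n t) (lookup qv k) (λ j → lookup (honest s n t j (column j qv)) k))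
  accepted k = fromWitness (Valid-resp {t = t} (λ _ → refl) (λ j → sym (decoded j k)) (honest-valid k))

balanced-offset : ∀ {s n} (qv : Vec (Fin (suc (suc s)) → Bool) n) →
                  ∃ λ (k : Fin (suc (n + n))) → T (balanced (Fin.toℕ k) qv)
balanced-offset {n = n} qv =
  Fin.fromℕ< bound , fromWitness (trans (cong (_+ c₀) (toℕ-fromℕ< bound)) (m∸n+n≡m c₀≤n+c₁))
  where
  c₀ c₁ : ℕ
  c₀ = ones (column zero qv)
  c₁ = ones (column (suc zero) qv)
  c₀≤n+c₁ : c₀ ≤ n + c₁
  c₀≤n+c₁ = ≤-trans (ones≤length (column zero qv)) (m≤m+n n c₁)
  bound : n + c₁ ∸ c₀ < suc (n + n)
  bound = s≤s (≤-trans (m∸n≤m (n + c₁) c₀) (+-monoʳ-≤ n (ones≤length (column (suc zero) qv))))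

offsetGame-value : ∀ s n → ∃ λ t →
  ratio 1 (suc (suc n) + suc n) ℚ.≤ repSuccessProb (offsetGame s n t) (suc n) (honest s n t)
offsetGame-value s n =
  let k , len≤ = pigeonhole-countB (N + N) (balanced ∘ Fin.toℕ) balanced-offset rounds
      t        = Fin.toℕ k
  in  t , reciprocal≤ratio (N + N) _ _ nonempty
            (≤-trans len≤ (*-monoʳ-≤ (suc (N + N)) (countB-mono rounds (honest-wins s n t))))
  where
  N = suc n
  r = suc (suc s)
  rounds = allVecs (Qbar r) N
  nonempty : 1 ≤ length rounds
  nonempty =
    let q , q∈ , _ = Qbar-complete (unit {r} zero) (sumFin-unit {r} zero)
    in  ∈⇒1≤length (∈-allVecs⁺ {v = replicate N q} (λ p → subst (_∈ Qbar r) (sym (lookup-replicate p q)) q∈))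

-- One position p of the claims at e₀, e₁, e₂: aⱼ and bⱼ are the bits claimed by prover j
-- on input 0 and 1, R collects the provers j ≥ 3, which get input 0 in all three questions.
column-balance : ∀ (a₀ a₁ a₂ b₀ b₁ b₂ : Bool) R →
                 bit b₀ + (bit a₁ + (bit a₂ + R)) ≡ 1 →
                 bit a₀ + (bit b₁ + (bit a₂ + R)) ≡ 1 →
                 bit a₀ + (bit a₁ + (bit b₂ + R)) ≡ 1 →
                 bit a₀ ≤ bit b₀ × bit b₀ + bit a₁ ≡ bit b₁ + bit a₀
column-balance false a₁ a₂ b₀ b₁ _ R h₀ h₁ _ = z≤n , +-cancelʳ-≡ (bit a₂ + R) _ _ (begin
  bit b₀ + bit a₁ + (bit a₂ + R)  ≡⟨ +-assoc (bit b₀) (bit a₁) _ ⟩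
  bit b₀ + (bit a₁ + (bit a₂ + R)) ≡⟨ trans h₀ (sym h₁) ⟩
  bit b₁ + (bit a₂ + R)           ≡⟨ cong (_+ (bit a₂ + R)) (+-identityʳ (bit b₁)) ⟨
  bit b₁ + 0 + (bit a₂ + R)       ∎)
  where open ≡-Reasoning
column-balance true true  _ _     _     _ _ _  _  ()
column-balance true false _ _     true  _ _ _  () _
column-balance true false _ true  false _ _ _  _  _ = s≤s z≤n , refl
column-balance true false _ false false _ _ h₀ h₁ _ with () ← trans (sym h₀) (suc-injective h₁)

offsets-inconsistent : ∀ {t n a b c d} → c < a → t + a ≡ n + b → t + c ≡ n + d → a + b ≡ d + c → ⊥
offsets-inconsistent {t} {n} {a} {b} {c} {d} c<a offset₀ offset₁ balance =
  <-irrefl (+-cancelʳ-≡ (t + b) _ _ (begin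
    c + c + (t + b)     ≡⟨ shuffle t c b ⟨
    t + c + (c + b)     ≡⟨ cong ((t + c) +_) (+-comm c b) ⟩
    t + c + (b + c)     ≡⟨ cong (_+ (b + c)) offset₁ ⟩
    n + d + (b + c)     ≡⟨ interchange n b d c ⟨
    n + b + (d + c)     ≡⟨ cong₂ _+_ offset₀ balance ⟨
    t + a + (a + b)     ≡⟨ shuffle t a b ⟩
    a + a + (t + b)     ∎)) (+-mono-< c<a c<a)
  where
  open ≡-Reasoning
  shuffle : ∀ t x y → t + x + (x + y) ≡ x + x + (t + y)
  shuffle = solve-∀

-- Prover 2 gets input 0 in both e₀ and e₁, so prover 0's claims on inputs 1 and 0 name
-- the same coordinate κ, where they read 1 and 0. Together with the partition constraints
-- this makes #V₀ > #U₀ while #V₀ + #U₁ = #V₁ + #U₀, contradicting the offset tests.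
no-valid-claims : ∀ {s n} t (claim : Fin (suc (suc (suc s))) → Bool → Claim n) →
                  ¬ (∀ i → Valid t (unit i) (λ j → claim j (unit i j)))
no-valid-claims {s} {n} t claim valid
  with valid zero | valid (suc zero) | valid (suc (suc zero))
... | sameRound₀ , partition₀ , consistent₀ , offset₀
    | sameRound₁ , partition₁ , consistent₁ , offset₁
    | _          , partition₂ , _           , _
    = offsets-inconsistent ones-U₀<ones-V₀ offset₀ offset₁ balance
  where
  U V : Fin (suc (suc (suc s))) → Vec Bool n
  U j = proj₁ (claim j false)
  V j = proj₁ (claim j true)

  κ : Fin n
  κ = proj₂ (claim zero false)

  same-κ : proj₂ (claim zero true) ≡ κ
  same-κ = trans (sym (sameRound₀ (suc (suc zero)))) (sameRound₁ (suc (suc zero)))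

  V₀-κ : lookup (V zero) κ ≡ true
  V₀-κ = subst (λ k → lookup (V zero) k ≡ true) same-κ (consistent₀ zero)

  u v : Fin (suc (suc (suc s))) → Fin n → ℕ
  u j p = bit (lookup (U j) p)
  v j p = bit (lookup (V j) p)

  columns : ∀ p → u zero p ≤ v zero p × v zero p + u (suc zero) p ≡ v (suc zero) p + u zero p
  columns p = column-balance (lookup (U zero) p) (lookup (U (suc zero)) p) (lookup (U (suc (suc zero))) p)
                             (lookup (V zero) p) (lookup (V (suc zero)) p) (lookup (V (suc (suc zero))) p)
                             _ (partition₀ p) (partition₁ p) (partition₂ p)

  balance : ones (V zero) + ones (U (suc zero)) ≡ ones (V (suc zero)) + ones (U zero)
  balance = trans (sym (sumFin-+ n _ _)) (trans (sumFin-cong n (proj₂ ∘ columns)) (sumFin-+ n _ _))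

  ones-U₀<ones-V₀ : ones (U zero) < ones (V zero)
  ones-U₀<ones-V₀ = sumFin-mono-< n (proj₁ ∘ columns) κ
    (subst₂ (λ a b → bit a < bit b) (sym (consistent₁ zero)) (sym V₀-κ) ≤-refl)

offsetGame-nonTrivial : ∀ s n t → NonTrivial (offsetGame (suc s) n t)
offsetGame-nonTrivial s n t (S , certain) = no-valid-claims t claim valid-at-unit
  where
  r = suc (suc (suc s))

  claim : Fin r → Bool → Claim (suc n)
  claim j b = decodeClaim n (S j b)

  wins : ∀ {q} → q ∈ Qbar r → T (Game.V (offsetGame (suc s) n t) q (λ j → S j (q j)))
  wins = countB≡length⇒T _ (Qbar r) (ratio≡1⇒≡ _ _ certain)

  valid-at-unit : ∀ i → Valid t (unit i) (λ j → claim j (unit i j))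
  valid-at-unit i =
    let q , q∈ , q≗unit = Qbar-complete (unit i) (sumFin-unit i)
    in  Valid-resp {t = t} q≗unit (λ j → cong (claim j) (q≗unit j)) (toWitness (wins q∈))

theorem1p9 : (r : ℕ) → 3 ≤ r → ¬ AdmitsExpParRep (Qbar r)
theorem1p9 (suc (suc (suc s))) (s≤s (s≤s (s≤s _))) (C , C<1 , ω≤Cⁿ) =
  let n , Cⁿ<reciprocal = ^ℚ<reciprocal C<1
      t , reciprocal≤value = offsetGame-value (suc s) n
      value≤Cⁿ = ω≤Cⁿ (suc n) (offsetGame (suc s) n t) (offsetGame-nonTrivial s n t) (honest (suc s) n t)
  in  ℚ.<-irrefl refl (ℚ.≤-<-trans (ℚ.≤-trans reciprocal≤value value≤Cⁿ) Cⁿ<reciprocal)
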